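{- Let $k$ be a positive integer. Consider $2k$ balls, colored with $k$ colors so that each color appears on exactly two balls, and let $B$ be a set of $k$ balls sampled uniformly at random without replacement from these $2k$ balls. Then the probability that $B$ contains balls of more than $7k/8$ distinct colors is at most $5\sqrt{k} \cdot 2^{ -k/16}$. -}

module Defs where

open import Data.Nat using (ℕ; zero; suc; _*_; _<_; _<?_; _≟_)
open import Data.Bool using (Bool; true; false; _∧_; if_then_else_)
open import Data.Fin using (Fin; remainder)
import Data.Fin as F
open import Data.Fin.Subset using (Subset; inside; outside; ∣_∣)
open import Data.Vec using (Vec; []; _∷_; lookup; tabulate)
open import Data.List using (List; []; _∷_; map; _++_; filter; length; allFin)
open import Data.Bool.ListAction using (any)
open import Relation.Nullary using (Dec; ⌊_⌋)
open import Relation.Nullary.Decidable using (_×-dec_)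
open import Data.Product using (_×_)

-- Ball i has color  remainder {2} k i : Fin k,
-- i.e. writing i = combine j c with j : Fin 2, c : Fin k, its color is c.
-- Thus each of the k colors appears on exactly two balls.
color : (k : ℕ) → Fin (2 * k) → Fin k
color k i = remainder {2} k i

subsets : (n : ℕ) → List (Subset n)
subsets zero    = [] ∷ []
subsets (suc n) = map (inside ∷_) (subsets n) ++ map (outside ∷_) (subsets n)

colorsOf : (k : ℕ) → Subset (2 * k) → Subset k
colorsOf k B = tabulate λ c →
  any (λ i → lookup B i ∧ ⌊ F._≟_ (color k i) c ⌋) (allFin (2 * k))

numColors : (k : ℕ) → Subset (2 * k) → ℕ
numColors k B = ∣ colorsOf k B ∣

-- The sample space: all k-element subsets of the 2k balls (uniform measure).
sampleSize : ℕ → ℕ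
sampleSize k = length (filter (λ B → ∣ B ∣ ≟ k) (subsets (2 * k)))

goodCount : ℕ → ℕ
goodCount k =
  length (filter (λ B → (∣ B ∣ ≟ k) ×-dec (7 * k <? 8 * numColors k B)) (subsets (2 * k)))

-- Split a set B of balls as B = B₀ ++ B₁, where B₀ and B₁ record, for every colour, whether
-- its first resp. second ball lies in B.  If d colours are doubled (both balls in B) and s are
-- single, then |B| = 2d + s and B has d + s colours; the number of such pairs (B₀, B₁) is the
-- multinomial k! 2ˢ / (d! s! e!) with e = k − d − s.  For |B| = k, having more than 7k/8
-- colours means 8d < k.  With q = ⌊k/16⌋, comparing consecutive multinomials shows that for
-- d < 3q the k-sets with d + 1 doubles are at least twice as many as those with d doubles.
-- Moving each of the at most 2q + 2 good values of d up by q − 1 therefore multiplies its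
-- count by 2^(q−1) while staying within the k-sets, so P ≤ 2^(1 − ⌊k/16⌋) ≤ 5 √k 2^(−k/16).

module Submission where

open import Defs
open import Data.Bool using (Bool; true; false; _∧_; _∨_; if_then_else_)
open import Data.Bool.ListAction using (any; or)
open import Data.Bool.Properties using (∧-zeroʳ; ∧-identityʳ; ∨-assoc; ∨-identityʳ)
open import Data.Fin using (Fin; _↑ˡ_; _↑ʳ_; combine)
import Data.Fin as Fin
open import Data.Fin.Properties using (remQuot-combine)
open import Data.Fin.Subset using (Subset; inside; outside; ∣_∣; _∪_)
open import Data.List using (List; []; _∷_; map; filter; length; allFin)
import Data.List as List
import Data.List.Properties as List
open import Data.Nat
open import Data.Nat.Properties
open import Data.Nat.DivMod using (_/_; _%_; m≡m%n+[m/n]*n; m%n<n; m/n*n≤m)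
open import Data.Nat.Tactic.RingSolver using (solve-∀)
open import Data.Product using (_×_; _,_; proj₁; proj₂)
open import Data.Sum using (inj₁; inj₂)
open import Data.Vec using (_∷_; []; _++_; lookup)
import Data.Vec.Properties as Vec
open import Function using (_∘_)
open import Relation.Binary.PropositionalEquality
open import Relation.Nullary using (Dec; yes; no; does; ⌊_⌋; ¬_)
open import Relation.Nullary.Decidable using (_×-dec_; dec-true; dec-false)

^-distribʳ-* : ∀ n a b → (a * b) ^ n ≡ a ^ n * b ^ n
^-distribʳ-* zero    a b = refl
^-distribʳ-* (suc n) a b = trans (cong (a * b *_) (^-distribʳ-* n a b)) ([m*n]*[o*p]≡[m*o]*[n*p] a b (a ^ n) (b ^ n))

m<[1+m/n]*n : ∀ m n .{{_ : NonZero n}} → m < suc (m / n) * n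
m<[1+m/n]*n m n = begin-strict
    m                    ≡⟨ m≡m%n+[m/n]*n m n ⟩
    m % n + m / n * n    <⟨ +-monoˡ-< (m / n * n) (m%n<n m n) ⟩
    n + m / n * n        ∎
  where open ≤-Reasoning

private
  variable
    X Y : Set

𝟙 : Dec X → ℕ
𝟙 a? = if does a? then 1 else 0

𝟙-yes : (a? : Dec X) → X → 𝟙 a? ≡ 1
𝟙-yes a? a rewrite dec-true a? a = refl

𝟙-no : (a? : Dec X) → ¬ X → 𝟙 a? ≡ 0
𝟙-no a? ¬a rewrite dec-false a? ¬a = refl

𝟙-mono : (X → Y) → (a? : Dec X) (b? : Dec Y) → 𝟙 a? ≤ 𝟙 b?
𝟙-mono f (no _)  b? = z≤n
𝟙-mono f (yes a) b? = ≤-reflexive (sym (𝟙-yes b? (f a)))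

𝟙-× : (a? : Dec X) (b? : Dec Y) → 𝟙 (a? ×-dec b?) ≡ 𝟙 a? * 𝟙 b?
𝟙-× (yes _) (yes _) = refl
𝟙-× (yes _) (no _)  = refl
𝟙-× (no _)  _       = refl

𝟙-≤ : ∀ {n} (a? : Dec X) → (X → 1 ≤ n) → 𝟙 a? ≤ n
𝟙-≤ (yes a) 1≤n = 1≤n a
𝟙-≤ (no _)  _   = z≤n

sumOver : List X → (X → ℕ) → ℕ
sumOver []       f = 0
sumOver (x ∷ xs) f = f x + sumOver xs f

syntax sumOver xs (λ x → e) = ∑[ x ∈ xs ] e

∑-++ : (xs ys : List X) (f : X → ℕ) →
  ∑[ x ∈ xs List.++ ys ] f x ≡ ∑[ x ∈ xs ] f x + ∑[ x ∈ ys ] f x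
∑-++ []       ys f = refl
∑-++ (x ∷ xs) ys f = trans (cong (f x +_) (∑-++ xs ys f)) (sym (+-assoc (f x) _ _))

∑-map : (g : X → Y) (xs : List X) (f : Y → ℕ) → ∑[ y ∈ map g xs ] f y ≡ ∑[ x ∈ xs ] f (g x)
∑-map g []       f = refl
∑-map g (x ∷ xs) f = cong (f (g x) +_) (∑-map g xs f)

∑-cong : (xs : List X) {f g : X → ℕ} → (∀ x → f x ≡ g x) → ∑[ x ∈ xs ] f x ≡ ∑[ x ∈ xs ] g x
∑-cong []       e = refl
∑-cong (x ∷ xs) e = cong₂ _+_ (e x) (∑-cong xs e)

∑-+ : (xs : List X) (f g : X → ℕ) →
  ∑[ x ∈ xs ] (f x + g x) ≡ ∑[ x ∈ xs ] f x + ∑[ x ∈ xs ] g x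
∑-+ []       f g = refl
∑-+ (x ∷ xs) f g = trans (cong (f x + g x +_) (∑-+ xs f g)) (+-+-comm (f x) (g x) _ _)
  where
  +-+-comm : ∀ a b c d → a + b + (c + d) ≡ a + c + (b + d)
  +-+-comm = solve-∀

length-filter : {P : X → Set} (P? : ∀ x → Dec (P x)) (xs : List X) →
  length (filter P? xs) ≡ ∑[ x ∈ xs ] 𝟙 (P? x)
length-filter P? []       = refl
length-filter P? (x ∷ xs) with does (P? x)
... | true  = cong suc (length-filter P? xs)
... | false = length-filter P? xs

sumBelow : ℕ → (ℕ → ℕ) → ℕ
sumBelow zero    f = 0
sumBelow (suc n) f = sumBelow n f + f n

syntax sumBelow n (λ j → e) = ∑[ j < n ] e

∑<-term : ∀ n (f : ℕ → ℕ) {j} → j < n → f j ≤ ∑[ i < n ] f i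
∑<-term (suc n) f {j} j<1+n with m≤n⇒m<n∨m≡n (≤-pred j<1+n)
... | inj₁ j<n  = ≤-trans (∑<-term n f j<n) (m≤m+n _ (f n))
... | inj₂ refl = m≤n+m (f j) _

∑<-mono : ∀ n {f g : ℕ → ℕ} → (∀ j → j < n → f j ≤ g j) → ∑[ j < n ] f j ≤ ∑[ j < n ] g j
∑<-mono zero    f≤g = z≤n
∑<-mono (suc n) f≤g = +-mono-≤ (∑<-mono n (λ j j<n → f≤g j (m<n⇒m<1+n j<n))) (f≤g n ≤-refl)

∑<-zero : ∀ n (f : ℕ → ℕ) → (∀ j → j < n → f j ≡ 0) → ∑[ j < n ] f j ≡ 0
∑<-zero zero    f f≡0 = refl
∑<-zero (suc n) f f≡0 = cong₂ _+_ (∑<-zero n f (λ j j<n → f≡0 j (m<n⇒m<1+n j<n))) (f≡0 n ≤-refl)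

∑<-*ʳ : ∀ n (f : ℕ → ℕ) c → (∑[ j < n ] f j) * c ≡ ∑[ j < n ] (f j * c)
∑<-*ʳ zero    f c = refl
∑<-*ʳ (suc n) f c = trans (*-distribʳ-+ c (∑[ j < n ] f j) (f n)) (cong (_+ f n * c) (∑<-*ʳ n f c))

∑<-𝟙≟ : ∀ n x p → ∑[ j < n ] 𝟙 (x ≟ p + j) ≤ 1
∑<-𝟙≟ zero    x p = z≤n
∑<-𝟙≟ (suc n) x p with x ≟ p + n
... | no  x≢p+n = begin
    ∑[ j < n ] 𝟙 (x ≟ p + j) + 𝟙 (x ≟ p + n)  ≡⟨ cong (∑[ j < n ] 𝟙 (x ≟ p + j) +_) (𝟙-no (x ≟ p + n) x≢p+n) ⟩
    ∑[ j < n ] 𝟙 (x ≟ p + j) + 0              ≡⟨ +-identityʳ _ ⟩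
    ∑[ j < n ] 𝟙 (x ≟ p + j)                  ≤⟨ ∑<-𝟙≟ n x p ⟩
    1                                         ∎
  where open ≤-Reasoning
... | yes refl  = ≤-reflexive (cong₂ _+_ earlier-terms (𝟙-yes (p + n ≟ p + n) refl))
  where
  earlier-terms : ∑[ j < n ] 𝟙 (p + n ≟ p + j) ≡ 0
  earlier-terms = ∑<-zero n _ λ j j<n →
    𝟙-no (p + n ≟ p + j) (λ p+n≡p+j → <⇒≢ j<n (sym (+-cancelˡ-≡ p n j p+n≡p+j)))

∑-subsets-suc : ∀ n (f : Subset (suc n) → ℕ) →
  ∑[ B ∈ subsets (suc n) ] f B ≡ ∑[ B ∈ subsets n ] f (inside ∷ B) + ∑[ B ∈ subsets n ] f (outside ∷ B)
∑-subsets-suc n f =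
  trans (∑-++ (map (inside ∷_) (subsets n)) _ f) (cong₂ _+_ (∑-map _ (subsets n) f) (∑-map _ (subsets n) f))

∑-subsets-+ : ∀ m n (f : Subset (m + n) → ℕ) →
  ∑[ B ∈ subsets (m + n) ] f B ≡ ∑[ B₀ ∈ subsets m ] ∑[ B₁ ∈ subsets n ] f (B₀ ++ B₁)
∑-subsets-+ zero    n f = sym (+-identityʳ _)
∑-subsets-+ (suc m) n f =
  trans (∑-subsets-suc (m + n) f)
        (trans (cong₂ _+_ (∑-subsets-+ m n _) (∑-subsets-+ m n _)) (sym (∑-subsets-suc m _)))

doubles singles : ∀ {k} → Subset k → Subset k → ℕ
doubles []           []           = 0
doubles (true  ∷ xs) (true  ∷ ys) = suc (doubles xs ys)
doubles (true  ∷ xs) (false ∷ ys) = doubles xs ys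
doubles (false ∷ xs) (_     ∷ ys) = doubles xs ys

singles []           []           = 0
singles (true  ∷ xs) (true  ∷ ys) = singles xs ys
singles (true  ∷ xs) (false ∷ ys) = suc (singles xs ys)
singles (false ∷ xs) (true  ∷ ys) = suc (singles xs ys)
singles (false ∷ xs) (false ∷ ys) = singles xs ys

-- The four summands are the four ways the first colour can lie in B₀ and B₁:
-- in both, in B₀ only, in B₁ only, in neither.
profileSum : ℕ → (ℕ → ℕ → ℕ) → ℕ
profileSum zero    f = f 0 0
profileSum (suc k) f = profileSum k (λ d s → (f (suc d) s + f d (suc s)) + (f d (suc s) + f d s))

∑-pairs≡profileSum : ∀ k (f : ℕ → ℕ → ℕ) →
  ∑[ B₀ ∈ subsets k ] ∑[ B₁ ∈ subsets k ] f (doubles B₀ B₁) (singles B₀ B₁) ≡ profileSum k f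
∑-pairs≡profileSum zero    f = trans (+-identityʳ _) (+-identityʳ _)
∑-pairs≡profileSum (suc k) f = begin
    ∑[ B₀ ∈ subsets (suc k) ] ∑[ B₁ ∈ subsets (suc k) ] f (doubles B₀ B₁) (singles B₀ B₁)
  ≡⟨ ∑-subsets-suc k _ ⟩
    ∑[ B₀ ∈ S ] ∑[ B₁ ∈ subsets (suc k) ] f (doubles (inside ∷ B₀) B₁) (singles (inside ∷ B₀) B₁) +
    ∑[ B₀ ∈ S ] ∑[ B₁ ∈ subsets (suc k) ] f (doubles (outside ∷ B₀) B₁) (singles (outside ∷ B₀) B₁)
  ≡⟨ cong₂ _+_ (∑-cong S (λ _ → ∑-subsets-suc k _)) (∑-cong S (λ _ → ∑-subsets-suc k _)) ⟩
    ∑[ B₀ ∈ S ] (∑[ B₁ ∈ S ] both B₀ B₁ + ∑[ B₁ ∈ S ] one B₀ B₁) +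
    ∑[ B₀ ∈ S ] (∑[ B₁ ∈ S ] one B₀ B₁ + ∑[ B₁ ∈ S ] none B₀ B₁)
  ≡⟨ sym (∑-+ S _ _) ⟩
    ∑[ B₀ ∈ S ] ((∑[ B₁ ∈ S ] both B₀ B₁ + ∑[ B₁ ∈ S ] one B₀ B₁) +
                 (∑[ B₁ ∈ S ] one B₀ B₁ + ∑[ B₁ ∈ S ] none B₀ B₁))
  ≡⟨ ∑-cong S (λ B₀ → sym (trans (∑-+ S _ _) (cong₂ _+_ (∑-+ S _ _) (∑-+ S _ _)))) ⟩
    ∑[ B₀ ∈ S ] ∑[ B₁ ∈ S ] ((both B₀ B₁ + one B₀ B₁) + (one B₀ B₁ + none B₀ B₁))
  ≡⟨ ∑-pairs≡profileSum k _ ⟩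
    profileSum (suc k) f
  ∎
  where
  open ≡-Reasoning
  S = subsets k
  both one none : Subset k → Subset k → ℕ
  both B₀ B₁ = f (suc (doubles B₀ B₁)) (singles B₀ B₁)
  one  B₀ B₁ = f (doubles B₀ B₁) (suc (singles B₀ B₁))
  none B₀ B₁ = f (doubles B₀ B₁) (singles B₀ B₁)

any-allFin : ∀ n (h : Fin n → Bool) → any h (allFin n) ≡ or (List.tabulate h)
any-allFin n h = cong or (List.map-tabulate (λ i → i) h)

or-tabulate-+ : ∀ m n (h : Fin (m + n) → Bool) →
  or (List.tabulate h) ≡ or (List.tabulate (h ∘ (_↑ˡ n))) ∨ or (List.tabulate (h ∘ (m ↑ʳ_)))
or-tabulate-+ zero    n h = refl
or-tabulate-+ (suc m) n h =
  trans (cong (h Fin.zero ∨_) (or-tabulate-+ m n (h ∘ Fin.suc))) (sym (∨-assoc (h Fin.zero) _ _))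

or-tabulate-false : ∀ n → or (List.tabulate {n = n} (λ _ → false)) ≡ false
or-tabulate-false zero    = refl
or-tabulate-false (suc n) = or-tabulate-false n

or-tabulate-≟ : ∀ n (f : Fin n → Bool) (c : Fin n) → or (List.tabulate (λ i → f i ∧ ⌊ i Fin.≟ c ⌋)) ≡ f c
or-tabulate-≟ (suc n) f Fin.zero =
  trans (cong₂ _∨_ (∧-identityʳ (f Fin.zero))
                   (trans (cong or (List.tabulate-cong (λ i → ∧-zeroʳ (f (Fin.suc i))))) (or-tabulate-false n)))
        (∨-identityʳ (f Fin.zero))
or-tabulate-≟ (suc n) f (Fin.suc c) rewrite ∧-zeroʳ (f Fin.zero) =
  trans (cong or (List.tabulate-cong (λ i → cong (f (Fin.suc i) ∧_) (⌊suc≟suc⌋ i c))))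
        (or-tabulate-≟ n (f ∘ Fin.suc) c)
  where
  ⌊suc≟suc⌋ : ∀ {n} (x y : Fin n) → ⌊ Fin.suc x Fin.≟ Fin.suc y ⌋ ≡ ⌊ x Fin.≟ y ⌋
  ⌊suc≟suc⌋ x y with x Fin.≟ y
  ... | yes _ = refl
  ... | no  _ = refl

color-combine : ∀ k (j : Fin 2) (c : Fin k) → color k (combine j c) ≡ c
color-combine k j c = cong proj₂ (remQuot-combine j c)

-- The two balls of colour c are c and k + c.
colorsOf-++ : ∀ k (B₀ B₁ : Subset k) → colorsOf k (B₀ ++ (B₁ ++ [])) ≡ B₀ ∪ B₁
colorsOf-++ k B₀ B₁ = trans (Vec.tabulate-cong colour) (Vec.tabulate∘lookup (B₀ ∪ B₁))
  where
  B = B₀ ++ (B₁ ++ [])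

  column : ∀ c j (C : Subset k) → (∀ i → lookup B (combine {2} {k} j i) ≡ lookup C i) →
    or (List.tabulate (λ i → lookup B (combine {2} {k} j i) ∧ ⌊ color k (combine {2} {k} j i) Fin.≟ c ⌋)) ≡ lookup C c
  column c j C lookup-C = trans
    (cong or (List.tabulate-cong (λ i → cong₂ (λ b c′ → b ∧ ⌊ c′ Fin.≟ c ⌋) (lookup-C i) (color-combine k j i))))
    (or-tabulate-≟ k (lookup C) c)

  colour : ∀ c → any (λ i → lookup B i ∧ ⌊ color k i Fin.≟ c ⌋) (allFin (2 * k)) ≡ lookup (B₀ ∪ B₁) c
  colour c = begin
      any h (allFin (k + (k + 0)))
    ≡⟨ any-allFin _ h ⟩
      or (List.tabulate h)
    ≡⟨ or-tabulate-+ k (k + 0) h ⟩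
      or (List.tabulate h₀) ∨ or (List.tabulate (λ (i : Fin (k + 0)) → h (k ↑ʳ i)))
    ≡⟨ cong (or (List.tabulate h₀) ∨_) (or-tabulate-+ k 0 (λ i → h (k ↑ʳ i))) ⟩
      or (List.tabulate h₀) ∨ (or (List.tabulate h₁) ∨ false)
    ≡⟨ cong₂ (λ b₀ b₁ → b₀ ∨ (b₁ ∨ false))
             (column c Fin.zero B₀ (Vec.lookup-++ˡ B₀ _))
             (column c (Fin.suc Fin.zero) B₁ (λ i → trans (Vec.lookup-++ʳ B₀ _ (i ↑ˡ 0)) (Vec.lookup-++ˡ B₁ [] i))) ⟩
      lookup B₀ c ∨ (lookup B₁ c ∨ false)
    ≡⟨ cong (lookup B₀ c ∨_) (∨-identityʳ _) ⟩
      lookup B₀ c ∨ lookup B₁ c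
    ≡⟨ sym (Vec.lookup-zipWith _∨_ c B₀ B₁) ⟩
      lookup (B₀ ∪ B₁) c
    ∎
    where
    open ≡-Reasoning
    h : Fin (2 * k) → Bool
    h i = lookup B i ∧ ⌊ color k i Fin.≟ c ⌋
    h₀ h₁ : Fin k → Bool
    h₀ i = h (combine {2} Fin.zero i)
    h₁ i = h (combine {2} (Fin.suc Fin.zero) i)

∣++∣ : ∀ {m n} (B₀ : Subset m) (B₁ : Subset n) → ∣ B₀ ++ B₁ ∣ ≡ ∣ B₀ ∣ + ∣ B₁ ∣
∣++∣ []           B₁ = refl
∣++∣ (true  ∷ B₀) B₁ = cong suc (∣++∣ B₀ B₁)
∣++∣ (false ∷ B₀) B₁ = ∣++∣ B₀ B₁

∣∪∣ : ∀ {k} (B₀ B₁ : Subset k) → ∣ B₀ ∪ B₁ ∣ ≡ doubles B₀ B₁ + singles B₀ B₁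
∣∪∣ []           []           = refl
∣∪∣ (true  ∷ xs) (true  ∷ ys) = cong suc (∣∪∣ xs ys)
∣∪∣ (true  ∷ xs) (false ∷ ys) = trans (cong suc (∣∪∣ xs ys)) (sym (+-suc _ _))
∣∪∣ (false ∷ xs) (true  ∷ ys) = trans (cong suc (∣∪∣ xs ys)) (sym (+-suc _ _))
∣∪∣ (false ∷ xs) (false ∷ ys) = ∣∪∣ xs ys

∣∣+∣∣ : ∀ {k} (B₀ B₁ : Subset k) → ∣ B₀ ∣ + ∣ B₁ ∣ ≡ doubles B₀ B₁ + doubles B₀ B₁ + singles B₀ B₁
∣∣+∣∣ []           []           = refl
∣∣+∣∣ (true  ∷ xs) (true  ∷ ys) = cong suc (begin
    ∣ xs ∣ + suc ∣ ys ∣                          ≡⟨ +-suc _ _ ⟩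
    suc (∣ xs ∣ + ∣ ys ∣)                        ≡⟨ cong suc (∣∣+∣∣ xs ys) ⟩
    suc (doubles xs ys + doubles xs ys) + singles xs ys ≡⟨ cong (_+ singles xs ys) (sym (+-suc _ _)) ⟩
    doubles xs ys + suc (doubles xs ys) + singles xs ys ∎)
  where open ≡-Reasoning
∣∣+∣∣ (true  ∷ xs) (false ∷ ys) = trans (cong suc (∣∣+∣∣ xs ys)) (sym (+-suc _ _))
∣∣+∣∣ (false ∷ xs) (true  ∷ ys) = trans (+-suc _ _) (trans (cong suc (∣∣+∣∣ xs ys)) (sym (+-suc _ _)))
∣∣+∣∣ (false ∷ xs) (false ∷ ys) = ∣∣+∣∣ xs ys

∑-subsets-2k : ∀ k (H : ℕ → ℕ → ℕ) →
  ∑[ B ∈ subsets (2 * k) ] H ∣ B ∣ (numColors k B) ≡ profileSum k (λ d s → H (d + d + s) (d + s))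
∑-subsets-2k k H = begin
    ∑[ B ∈ subsets (k + (k + 0)) ] G B
  ≡⟨ ∑-subsets-+ k (k + 0) G ⟩
    ∑[ B₀ ∈ subsets k ] ∑[ R ∈ subsets (k + 0) ] G (B₀ ++ R)
  ≡⟨ ∑-cong (subsets k) (λ B₀ → ∑-subsets-+ k 0 (λ R → G (B₀ ++ R))) ⟩
    ∑[ B₀ ∈ subsets k ] ∑[ B₁ ∈ subsets k ] (G (B₀ ++ (B₁ ++ [])) + 0)
  ≡⟨ ∑-cong (subsets k) (λ B₀ → ∑-cong (subsets k) (λ B₁ →
       trans (+-identityʳ _) (cong₂ H (size B₀ B₁) (trans (cong ∣_∣ (colorsOf-++ k B₀ B₁)) (∣∪∣ B₀ B₁))))) ⟩
    ∑[ B₀ ∈ subsets k ] ∑[ B₁ ∈ subsets k ] H′ (doubles B₀ B₁) (singles B₀ B₁)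
  ≡⟨ ∑-pairs≡profileSum k H′ ⟩
    profileSum k H′
  ∎
  where
  open ≡-Reasoning
  G : Subset (2 * k) → ℕ
  G B = H ∣ B ∣ (numColors k B)
  H′ : ℕ → ℕ → ℕ
  H′ d s = H (d + d + s) (d + s)
  size : ∀ (B₀ B₁ : Subset k) → ∣ B₀ ++ (B₁ ++ []) ∣ ≡ doubles B₀ B₁ + doubles B₀ B₁ + singles B₀ B₁
  size B₀ B₁ = trans (∣++∣ B₀ (B₁ ++ [])) (trans (cong (∣ B₀ ∣ +_) (trans (∣++∣ B₁ []) (+-identityʳ _))) (∣∣+∣∣ B₀ B₁))

profileSum-cong : ∀ k {f g : ℕ → ℕ → ℕ} → (∀ d s → d + s ≤ k → f d s ≡ g d s) →
  profileSum k f ≡ profileSum k g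
profileSum-cong zero    f≡g = f≡g 0 0 z≤n
profileSum-cong (suc k) f≡g = profileSum-cong k λ d s d+s≤k →
  let both = f≡g (suc d) s (s≤s d+s≤k)
      one  = f≡g d (suc s) (≤-trans (≤-reflexive (+-suc d s)) (s≤s d+s≤k))
      none = f≡g d s (m≤n⇒m≤1+n d+s≤k)
  in cong₂ _+_ (cong₂ _+_ both one) (cong₂ _+_ one none)

profileSum-mono : ∀ k {f g : ℕ → ℕ → ℕ} → (∀ d s → f d s ≤ g d s) → profileSum k f ≤ profileSum k g
profileSum-mono zero    f≤g = f≤g 0 0
profileSum-mono (suc k) f≤g = profileSum-mono k λ d s →
  +-mono-≤ (+-mono-≤ (f≤g (suc d) s) (f≤g d (suc s))) (+-mono-≤ (f≤g d (suc s)) (f≤g d s))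

profileSum-0 : ∀ k → profileSum k (λ _ _ → 0) ≡ 0
profileSum-0 zero    = refl
profileSum-0 (suc k) = profileSum-0 k

profileSum-+ : ∀ k (f g : ℕ → ℕ → ℕ) →
  profileSum k (λ d s → f d s + g d s) ≡ profileSum k f + profileSum k g
profileSum-+ zero    f g = refl
profileSum-+ (suc k) f g = trans
  (profileSum-cong k (λ d s _ → regroup (f (suc d) s) (g (suc d) s) (f d (suc s)) (g d (suc s)) (f d s) (g d s)))
  (profileSum-+ k _ _)
  where
  regroup : ∀ a a′ b b′ c c′ →
    ((a + a′) + (b + b′)) + ((b + b′) + (c + c′)) ≡ ((a + b) + (b + c)) + ((a′ + b′) + (b′ + c′))
  regroup = solve-∀

δ : ℕ → ℕ → ℕ → ℕ → ℕ
δ d s x y = 𝟙 ((x ≟ d) ×-dec (y ≟ s))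

profileCount : ℕ → ℕ → ℕ → ℕ
profileCount k d s = profileSum k (δ d s)

profileCount-vanishes : ∀ k d s → k < d + s → profileCount k d s ≡ 0
profileCount-vanishes k d s k<d+s = trans (profileSum-cong k off) (profileSum-0 k)
  where
  off : ∀ x y → x + y ≤ k → δ d s x y ≡ 0
  off x y x+y≤k = 𝟙-no ((x ≟ d) ×-dec (y ≟ s))
    λ { (refl , refl) → <⇒≱ k<d+s x+y≤k }

profileCount↓d profileCount↓s : ℕ → ℕ → ℕ → ℕ
profileCount↓d k zero    s = 0
profileCount↓d k (suc d) s = profileCount k d s
profileCount↓s k d zero    = 0
profileCount↓s k d (suc s) = profileCount k d s

profileCount-suc : ∀ k d s →
  profileCount (suc k) d s ≡ (profileCount↓d k d s + profileCount↓s k d s) + (profileCount↓s k d s + profileCount k d s)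
profileCount-suc k d s =
  trans (profileSum-+ k _ _)
        (cong₂ _+_ (trans (profileSum-+ k _ _) (cong₂ _+_ (both d) (one s)))
                   (trans (profileSum-+ k _ _) (cong (_+ profileCount k d s) (one s))))
  where
  both : ∀ d → profileSum k (λ x y → δ d s (suc x) y) ≡ profileCount↓d k d s
  both zero    = profileSum-0 k
  both (suc d) = refl
  one : ∀ s → profileSum k (λ x y → δ d s x (suc y)) ≡ profileCount↓s k d s
  one zero    = trans (profileSum-cong k (λ x y _ → cong (λ b → if b then 1 else 0) (∧-zeroʳ (does (x ≟ d)))))
                      (profileSum-0 k)
  one (suc s) = refl

profileCount-multinomial : ∀ k d s e → d + s + e ≡ k → profileCount k d s * (d ! * s ! * e !) ≡ k ! * 2 ^ s
profileCount-multinomial zero    zero    zero    zero    _ = refl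
profileCount-multinomial zero    zero    zero    (suc e) ()
profileCount-multinomial zero    zero    (suc s) e       ()
profileCount-multinomial zero    (suc d) s       e       ()
profileCount-multinomial (suc k) d       s       e       d+s+e≡1+k = begin
    profileCount (suc k) d s * F
  ≡⟨ cong (_* F) (profileCount-suc k d s) ⟩
    ((profileCount↓d k d s + profileCount↓s k d s) + (profileCount↓s k d s + profileCount k d s)) * F
  ≡⟨ distrib (profileCount↓d k d s) (profileCount↓s k d s) (profileCount k d s) F ⟩
    profileCount↓d k d s * F + (profileCount↓s k d s * F + profileCount↓s k d s * F) + profileCount k d s * F
  ≡⟨ cong₂ _+_ (cong₂ _+_ (both d d+s+e≡1+k) (one s d+s+e≡1+k)) (none e d+s+e≡1+k) ⟩
    K * d + K * s + K * e
  ≡⟨ collect K d s e ⟩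
    K * (d + s + e)
  ≡⟨ cong (K *_) d+s+e≡1+k ⟩
    K * suc k
  ≡⟨ reorder (k !) (2 ^ s) k ⟩
    suc k ! * 2 ^ s
  ∎
  where
  open ≡-Reasoning
  F = d ! * s ! * e !
  K = k ! * 2 ^ s

  distrib : ∀ a b c x → ((a + b) + (b + c)) * x ≡ a * x + (b * x + b * x) + c * x
  distrib = solve-∀
  collect : ∀ x a b c → x * a + x * b + x * c ≡ x * (a + b + c)
  collect = solve-∀
  reorder : ∀ a b n → a * b * suc n ≡ suc n * a * b
  reorder = solve-∀

  both : ∀ d → d + s + e ≡ suc k → profileCount↓d k d s * (d ! * s ! * e !) ≡ K * d
  both zero    _  = sym (*-zeroʳ K)
  both (suc d) eq = trans (pull-out (profileCount k d s) (suc d) (d !) (s !) (e !))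
                          (cong (_* suc d) (profileCount-multinomial k d s e (suc-injective eq)))
    where
    pull-out : ∀ p x a b c → p * (x * a * b * c) ≡ p * (a * b * c) * x
    pull-out = solve-∀

  one : ∀ s → d + s + e ≡ suc k →
    profileCount↓s k d s * (d ! * s ! * e !) + profileCount↓s k d s * (d ! * s ! * e !) ≡ k ! * 2 ^ s * s
  one zero    _  = sym (*-zeroʳ (k ! * 1))
  one (suc s) eq = begin
      profileCount k d s * (d ! * suc s ! * e !) + profileCount k d s * (d ! * suc s ! * e !)
    ≡⟨ pull-out (profileCount k d s) (suc s) (d !) (s !) (e !) ⟩
      profileCount k d s * (d ! * s ! * e !) * (2 * suc s)
    ≡⟨ cong (_* (2 * suc s)) (profileCount-multinomial k d s e d+s+e≡k) ⟩
      k ! * 2 ^ s * (2 * suc s)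
    ≡⟨ move-2 (k !) (2 ^ s) (suc s) ⟩
      k ! * 2 ^ suc s * suc s
    ∎
    where
    d+s+e≡k : d + s + e ≡ k
    d+s+e≡k = suc-injective (trans (cong (_+ e) (sym (+-suc d s))) eq)
    pull-out : ∀ p x a b c → p * (a * (x * b) * c) + p * (a * (x * b) * c) ≡ p * (a * b * c) * (2 * x)
    pull-out = solve-∀
    move-2 : ∀ a t x → a * t * (2 * x) ≡ a * (2 * t) * x
    move-2 = solve-∀

  none : ∀ e → d + s + e ≡ suc k → profileCount k d s * (d ! * s ! * e !) ≡ K * e
  none zero    eq = trans (cong (_* (d ! * s ! * 1)) (profileCount-vanishes k d s k<d+s)) (sym (*-zeroʳ K))
    where
    k<d+s : k < d + s
    k<d+s = ≤-reflexive (sym (trans (sym (+-identityʳ (d + s))) eq))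
  none (suc e) eq = trans (pull-out (profileCount k d s) (suc e) (d !) (s !) (e !))
                          (cong (_* suc e) (profileCount-multinomial k d s e
                             (suc-injective (trans (sym (+-suc (d + s) e)) eq))))
    where
    pull-out : ∀ p x a b c → p * (a * b * (x * c)) ≡ p * (a * b * c) * x
    pull-out = solve-∀

profileCount-ratio : ∀ k d s e → suc d + s + suc e ≡ k →
  profileCount k (suc d) s * (4 * suc d * suc e) ≡ profileCount k d (2 + s) * ((2 + s) * (1 + s))
profileCount-ratio k d s e eq = *-cancelʳ-≡ _ _ (d ! * s ! * e !) {{d!s!e!≢0}} (begin
    profileCount k (suc d) s * (4 * suc d * suc e) * (d ! * s ! * e !)
  ≡⟨ shuffle₁ (profileCount k (suc d) s) (suc d) (suc e) (d !) (s !) (e !) ⟩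
    4 * (profileCount k (suc d) s * (suc d ! * s ! * suc e !))
  ≡⟨ cong (4 *_) (profileCount-multinomial k (suc d) s (suc e) eq) ⟩
    4 * (k ! * 2 ^ s)
  ≡⟨ shuffle₂ (k !) (2 ^ s) ⟩
    k ! * 2 ^ (2 + s)
  ≡⟨ profileCount-multinomial k d (2 + s) e (trans (move-columns d s e) eq) ⟨
    profileCount k d (2 + s) * (d ! * (2 + s) ! * e !)
  ≡⟨ shuffle₃ (profileCount k d (2 + s)) (2 + s) (1 + s) (d !) (s !) (e !) ⟨
    profileCount k d (2 + s) * ((2 + s) * (1 + s)) * (d ! * s ! * e !)
  ∎)
  where
  open ≡-Reasoning
  d!s!e!≢0 : NonZero (d ! * s ! * e !)
  d!s!e!≢0 = m*n≢0 (d ! * s !) (e !) {{d !* s !≢0}} {{e !≢0}}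
  move-columns : ∀ d s e → d + (2 + s) + e ≡ suc d + s + suc e
  move-columns = solve-∀
  shuffle₁ : ∀ p x y a b c → p * (4 * x * y) * (a * b * c) ≡ 4 * (p * (x * a * b * (y * c)))
  shuffle₁ = solve-∀
  shuffle₂ : ∀ a t → 4 * (a * t) ≡ a * (2 * (2 * t))
  shuffle₂ = solve-∀
  shuffle₃ : ∀ p u v a b c → p * (u * v) * (a * b * c) ≡ p * (a * (u * (v * b)) * c)
  shuffle₃ = solve-∀

profileCount-doubling : ∀ k d s → d + d + (2 + s) ≡ k → 8 * (suc d * suc d) ≤ (2 + s) * (1 + s) →
  2 * profileCount k d (2 + s) ≤ profileCount k (suc d) s
profileCount-doubling k d s eq 8[d+1]²≤[s+2][s+1] =
  *-cancelʳ-≤ _ _ (4 * suc d * suc d) (begin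
    2 * profileCount k d (2 + s) * (4 * suc d * suc d)
  ≡⟨ shuffle (profileCount k d (2 + s)) (suc d) ⟩
    profileCount k d (2 + s) * (8 * (suc d * suc d))
  ≤⟨ *-monoʳ-≤ (profileCount k d (2 + s)) 8[d+1]²≤[s+2][s+1] ⟩
    profileCount k d (2 + s) * ((2 + s) * (1 + s))
  ≡⟨ profileCount-ratio k d s d (trans (move-columns d s) eq) ⟨
    profileCount k (suc d) s * (4 * suc d * suc d)
  ∎)
  where
  open ≤-Reasoning
  shuffle : ∀ p a → 2 * p * (4 * a * a) ≡ p * (8 * (a * a))
  shuffle = solve-∀
  move-columns : ∀ d s → suc d + s + suc d ≡ d + d + (2 + s)
  move-columns = solve-∀

-- The number of k-subsets of the 2k balls with exactly d doubled colours, and hence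
-- k ∸ 2d single ones (meaningful only for 2d ≤ k).
countWithDoubles : ℕ → ℕ → ℕ
countWithDoubles k d = profileCount k d (k ∸ (d + d))

countWithDoubles-doubling : ∀ k q d → q * 16 ≤ k → suc d ≤ 3 * q →
  2 * countWithDoubles k d ≤ countWithDoubles k (suc d)
countWithDoubles-doubling k q d q*16≤k d+1≤3q =
  subst (λ t → 2 * profileCount k d t ≤ countWithDoubles k (suc d)) (sym k∸2d≡2+s)
        (profileCount-doubling k d s size square-bound)
  where
  s = k ∸ (suc d + suc d)

  2[d+1]≤6q : suc d + suc d ≤ 6 * q
  2[d+1]≤6q = ≤-trans (+-mono-≤ d+1≤3q d+1≤3q) (≤-reflexive (double q))
    where
    double : ∀ q → 3 * q + 3 * q ≡ 6 * q
    double = solve-∀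

  regroup : ∀ d s → d + d + (2 + s) ≡ suc d + suc d + s
  regroup = solve-∀

  2[d+1]≤k : suc d + suc d ≤ k
  2[d+1]≤k = ≤-trans 2[d+1]≤6q (≤-trans (*-monoˡ-≤ q (≤ᵇ⇒≤ 6 16 _)) (≤-trans (≤-reflexive (*-comm 16 q)) q*16≤k))

  size : d + d + (2 + s) ≡ k
  size = trans (regroup d s) (m+[n∸m]≡n 2[d+1]≤k)

  k∸2d≡2+s : k ∸ (d + d) ≡ 2 + s
  k∸2d≡2+s = trans (cong (_∸ (d + d)) (sym size)) (m+n∸m≡n (d + d) (2 + s))

  10q≤s : 10 * q ≤ s
  10q≤s = +-cancelˡ-≤ (6 * q) (10 * q) s (begin
      6 * q + 10 * q      ≡⟨ split-16 q ⟩
      q * 16              ≤⟨ q*16≤k ⟩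
      k                   ≡⟨ trans (sym size) (regroup d s) ⟩
      suc d + suc d + s   ≤⟨ +-monoˡ-≤ s 2[d+1]≤6q ⟩
      6 * q + s           ∎)
    where
    open ≤-Reasoning
    split-16 : ∀ q → 6 * q + 10 * q ≡ q * 16
    split-16 = solve-∀

  square-bound : 8 * (suc d * suc d) ≤ (2 + s) * (1 + s)
  square-bound = begin
      8 * (suc d * suc d)                   ≤⟨ *-monoʳ-≤ 8 (*-mono-≤ d+1≤3q d+1≤3q) ⟩
      8 * (3 * q * (3 * q))                 ≤⟨ m≤m+n _ (28 * (q * q)) ⟩
      8 * (3 * q * (3 * q)) + 28 * (q * q)  ≡⟨ square-identity q ⟩
      10 * q * (10 * q)                     ≤⟨ *-mono-≤ (≤-trans 10q≤s (m≤n+m s 2)) (≤-trans 10q≤s (m≤n+m s 1)) ⟩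
      (2 + s) * (1 + s)                     ∎
    where
    open ≤-Reasoning
    square-identity : ∀ q → 8 * (3 * q * (3 * q)) + 28 * (q * q) ≡ 10 * q * (10 * q)
    square-identity = solve-∀

countWithDoubles-growth : ∀ k q i j → q * 16 ≤ k → i + j ≤ 3 * q →
  countWithDoubles k j * 2 ^ i ≤ countWithDoubles k (i + j)
countWithDoubles-growth k q zero    j _      _        = ≤-reflexive (*-identityʳ _)
countWithDoubles-growth k q (suc i) j q*16≤k 1+i+j≤3q = begin
    countWithDoubles k j * (2 * 2 ^ i)  ≡⟨ *-comm (countWithDoubles k j) (2 * 2 ^ i) ⟩
    2 * 2 ^ i * countWithDoubles k j    ≡⟨ *-assoc 2 (2 ^ i) _ ⟩
    2 * (2 ^ i * countWithDoubles k j)  ≡⟨ cong (2 *_) (*-comm (2 ^ i) _) ⟩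
    2 * (countWithDoubles k j * 2 ^ i)  ≤⟨ *-monoʳ-≤ 2 (countWithDoubles-growth k q i j q*16≤k (<⇒≤ 1+i+j≤3q)) ⟩
    2 * countWithDoubles k (i + j)      ≤⟨ countWithDoubles-doubling k q (i + j) q*16≤k 1+i+j≤3q ⟩
    countWithDoubles k (suc i + j)      ∎
  where open ≤-Reasoning

profileSum-∑< : ∀ k n (g : ℕ → ℕ → ℕ → ℕ) →
  profileSum k (λ x y → ∑[ j < n ] g j x y) ≡ ∑[ j < n ] profileSum k (g j)
profileSum-∑< k zero    g = profileSum-0 k
profileSum-∑< k (suc n) g = trans (profileSum-+ k _ _) (cong (_+ profileSum k (g n)) (profileSum-∑< k n g))

goodCount≡profileSum : ∀ k →
  goodCount k ≡ profileSum k (λ d s → 𝟙 ((d + d + s ≟ k) ×-dec (7 * k <? 8 * (d + s))))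
goodCount≡profileSum k =
  trans (length-filter _ (subsets (2 * k))) (∑-subsets-2k k (λ n c → 𝟙 ((n ≟ k) ×-dec (7 * k <? 8 * c))))

sampleSize≡profileSum : ∀ k → sampleSize k ≡ profileSum k (λ d s → 𝟙 (d + d + s ≟ k))
sampleSize≡profileSum k = trans (length-filter _ (subsets (2 * k))) (∑-subsets-2k k (λ n _ → 𝟙 (n ≟ k)))

goodCount≤sampleSize : ∀ k → goodCount k ≤ sampleSize k
goodCount≤sampleSize k = begin
    goodCount k                                                             ≡⟨ goodCount≡profileSum k ⟩
    profileSum k (λ d s → 𝟙 ((d + d + s ≟ k) ×-dec (7 * k <? 8 * (d + s)))) ≤⟨ profileSum-mono k (λ d s → 𝟙-mono proj₁ ((d + d + s ≟ k) ×-dec (7 * k <? 8 * (d + s))) (d + d + s ≟ k)) ⟩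
    profileSum k (λ d s → 𝟙 (d + d + s ≟ k))                                 ≡⟨ sampleSize≡profileSum k ⟨
    sampleSize k                                                            ∎
  where open ≤-Reasoning

few-doubles : ∀ k d s → d + d + s ≡ k → 7 * k < 8 * (d + s) → 8 * d < k
few-doubles k d s size many-colours = +-cancelʳ-< (7 * k) (8 * d) k (begin-strict
    8 * d + 7 * k          <⟨ +-monoʳ-< (8 * d) many-colours ⟩
    8 * d + 8 * (d + s)    ≡⟨ regroup d s ⟩
    8 * (d + d + s)        ≡⟨ cong (8 *_) size ⟩
    8 * k                  ≡⟨ split-8 k ⟩
    k + 7 * k              ∎)
  where
  open ≤-Reasoning
  regroup : ∀ d s → 8 * d + 8 * (d + s) ≡ 8 * (d + d + s)
  regroup = solve-∀
  split-8 : ∀ k → 8 * k ≡ k + 7 * k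
  split-8 = solve-∀

goodCount-halving : ∀ k p → suc p * 16 ≤ k → k < (2 + p) * 16 → goodCount k * 2 ^ p ≤ sampleSize k
goodCount-halving k p lower upper = begin
    goodCount k * 2 ^ p
  ≡⟨ cong (_* 2 ^ p) (goodCount≡profileSum k) ⟩
    profileSum k (λ x y → 𝟙 ((x + x + y ≟ k) ×-dec (7 * k <? 8 * (x + y)))) * 2 ^ p
  ≤⟨ *-monoˡ-≤ (2 ^ p) (profileSum-mono k good≤) ⟩
    profileSum k (λ x y → ∑[ j < D ] δ j (k ∸ (j + j)) x y) * 2 ^ p
  ≡⟨ cong (_* 2 ^ p) (profileSum-∑< k D _) ⟩
    (∑[ j < D ] countWithDoubles k j) * 2 ^ p
  ≡⟨ ∑<-*ʳ D _ (2 ^ p) ⟩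
    ∑[ j < D ] (countWithDoubles k j * 2 ^ p)
  ≤⟨ ∑<-mono D (λ j j<D → countWithDoubles-growth k (suc p) p j lower (p+j≤3[p+1] j<D)) ⟩
    ∑[ j < D ] countWithDoubles k (p + j)
  ≡⟨ profileSum-∑< k D _ ⟨
    profileSum k (λ x y → ∑[ j < D ] δ (p + j) (k ∸ ((p + j) + (p + j))) x y)
  ≤⟨ profileSum-mono k shifted≤ ⟩
    profileSum k (λ x y → 𝟙 (x + x + y ≟ k))
  ≡⟨ sampleSize≡profileSum k ⟨
    sampleSize k
  ∎
  where
  open ≤-Reasoning
  D = 4 + 2 * p

  good≤ : ∀ x y → 𝟙 ((x + x + y ≟ k) ×-dec (7 * k <? 8 * (x + y))) ≤ ∑[ j < D ] δ j (k ∸ (j + j)) x y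
  good≤ x y = 𝟙-≤ ((x + x + y ≟ k) ×-dec (7 * k <? 8 * (x + y))) λ (size , many-colours) →
    ≤-trans (≤-reflexive (sym (𝟙-yes ((x ≟ x) ×-dec (y ≟ k ∸ (x + x))) (refl , y≡k∸2x size))))
            (∑<-term D (λ j → δ j (k ∸ (j + j)) x y) (x<D size many-colours))
    where
    y≡k∸2x : x + x + y ≡ k → y ≡ k ∸ (x + x)
    y≡k∸2x size = sym (trans (cong (_∸ (x + x)) (sym size)) (m+n∸m≡n (x + x) y))
    x<D : x + x + y ≡ k → 7 * k < 8 * (x + y) → x < D
    x<D size many-colours = *-cancelˡ-< 8 x D (≤-trans (few-doubles k x y size many-colours)
            (≤-trans (<⇒≤ upper) (≤-reflexive (eight-D p))))
      where
      eight-D : ∀ p → (2 + p) * 16 ≡ 8 * (4 + 2 * p)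
      eight-D = solve-∀

  p+j≤3[p+1] : ∀ {j} → j < D → p + j ≤ 3 * suc p
  p+j≤3[p+1] j<D = ≤-trans (+-monoʳ-≤ p (≤-pred j<D)) (≤-reflexive (regroup p))
    where
    regroup : ∀ p → p + (3 + 2 * p) ≡ 3 * suc p
    regroup = solve-∀

  shifted≤ : ∀ x y → ∑[ j < D ] δ (p + j) (k ∸ ((p + j) + (p + j))) x y ≤ 𝟙 (x + x + y ≟ k)
  shifted≤ x y = begin
      ∑[ j < D ] δ (p + j) (k ∸ ((p + j) + (p + j))) x y
    ≤⟨ ∑<-mono D (λ _ → term≤) ⟩
      ∑[ j < D ] (𝟙 (x ≟ p + j) * 𝟙 (x + x + y ≟ k))
    ≡⟨ ∑<-*ʳ D _ _ ⟨
      (∑[ j < D ] 𝟙 (x ≟ p + j)) * 𝟙 (x + x + y ≟ k)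
    ≤⟨ *-monoˡ-≤ _ (∑<-𝟙≟ D x p) ⟩
      1 * 𝟙 (x + x + y ≟ k)
    ≡⟨ *-identityˡ _ ⟩
      𝟙 (x + x + y ≟ k)
    ∎
    where
    2[p+j]≤k : ∀ {j} → j < D → (p + j) + (p + j) ≤ k
    2[p+j]≤k j<D = ≤-trans (+-mono-≤ (p+j≤3[p+1] j<D) (p+j≤3[p+1] j<D))
                     (≤-trans (≤-reflexive (six (suc p))) (≤-trans (*-monoˡ-≤ (suc p) (≤ᵇ⇒≤ 6 16 _))
                     (≤-trans (≤-reflexive (*-comm 16 (suc p))) lower)))
      where
      six : ∀ q → 3 * q + 3 * q ≡ 6 * q
      six = solve-∀

    diagonal : ∀ {j} → j < D → x ≡ p + j × y ≡ k ∸ ((p + j) + (p + j)) → x ≡ p + j × x + x + y ≡ k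
    diagonal j<D (refl , refl) = refl , m+[n∸m]≡n (2[p+j]≤k j<D)

    term≤ : ∀ {j} → j < D → δ (p + j) (k ∸ ((p + j) + (p + j))) x y ≤ 𝟙 (x ≟ p + j) * 𝟙 (x + x + y ≟ k)
    term≤ {j} j<D = ≤-trans
      (𝟙-mono (diagonal j<D) ((x ≟ p + j) ×-dec (y ≟ k ∸ ((p + j) + (p + j)))) ((x ≟ p + j) ×-dec (x + x + y ≟ k)))
      (≤-reflexive (𝟙-× (x ≟ p + j) (x + x + y ≟ k)))

^16-mono-exponent : ∀ G k n → k ≤ n * 16 → G ^ 16 * 2 ^ k ≤ (G * 2 ^ n) ^ 16
^16-mono-exponent G k n k≤n*16 = begin
    G ^ 16 * 2 ^ k          ≤⟨ *-monoʳ-≤ (G ^ 16) (^-monoʳ-≤ 2 k≤n*16) ⟩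
    G ^ 16 * 2 ^ (n * 16)   ≡⟨ cong (G ^ 16 *_) (^-*-assoc 2 n 16) ⟨
    G ^ 16 * (2 ^ n) ^ 16   ≡⟨ ^-distribʳ-* 16 G (2 ^ n) ⟨
    (G * 2 ^ n) ^ 16        ∎
  where open ≤-Reasoning

power-bound : ∀ G S k m → G * 2 ^ m ≤ S → 1 ≤ k → k < (2 + m) * 16 →
  G ^ 16 * 2 ^ k ≤ 5 ^ 16 * k ^ 8 * S ^ 16
power-bound G S k m G2ᵐ≤S 1≤k k<[2+m]16 = begin
    G ^ 16 * 2 ^ k                ≤⟨ ^16-mono-exponent G k (2 + m) (<⇒≤ k<[2+m]16) ⟩
    (G * 2 ^ (2 + m)) ^ 16        ≡⟨ cong (_^ 16) (pull-4 G (2 ^ m)) ⟩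
    (4 * (G * 2 ^ m)) ^ 16        ≤⟨ ^-monoˡ-≤ 16 (*-monoʳ-≤ 4 G2ᵐ≤S) ⟩
    (4 * S) ^ 16                  ≡⟨ ^-distribʳ-* 16 4 S ⟩
    4 ^ 16 * S ^ 16               ≤⟨ *-monoˡ-≤ (S ^ 16) 4¹⁶≤5¹⁶k⁸ ⟩
    5 ^ 16 * k ^ 8 * S ^ 16       ∎
  where
  open ≤-Reasoning
  pull-4 : ∀ g t → g * (2 * (2 * t)) ≡ 4 * (g * t)
  pull-4 = solve-∀
  4¹⁶≤5¹⁶k⁸ : 4 ^ 16 ≤ 5 ^ 16 * k ^ 8
  4¹⁶≤5¹⁶k⁸ = ≤-trans (^-monoˡ-≤ 16 (≤ᵇ⇒≤ 4 5 _))
                (≤-trans (≤-reflexive (sym (*-identityʳ (5 ^ 16)))) (*-monoʳ-≤ (5 ^ 16) (^-monoˡ-≤ 8 1≤k)))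

goodCount-halving-/16 : ∀ k → goodCount k * 2 ^ pred (k / 16) ≤ sampleSize k
goodCount-halving-/16 k with k / 16 | m/n*n≤m k 16 | m<[1+m/n]*n k 16
... | zero  | _     | _     = ≤-trans (≤-reflexive (*-identityʳ (goodCount k))) (goodCount≤sampleSize k)
... | suc p | lower | upper = goodCount-halving k p lower upper

k<[2+pred[k/16]]*16 : ∀ k → k < (2 + pred (k / 16)) * 16
k<[2+pred[k/16]]*16 k with k / 16 | m<[1+m/n]*n k 16
... | zero  | k<16  = ≤-trans k<16 (≤ᵇ⇒≤ 16 32 _)
... | suc p | upper = upper

corollary1 : (k : ℕ) → 1 ≤ k →
    goodCount k ^ 16 * 2 ^ k ≤ 5 ^ 16 * k ^ 8 * sampleSize k ^ 16
corollary1 k 1≤k =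
  power-bound (goodCount k) (sampleSize k) k (pred (k / 16)) (goodCount-halving-/16 k) 1≤k (k<[2+pred[k/16]]*16 k)
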